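{- Let $k\in\mathbb{N}$ with $k\ge 2$, let $\mathbf{X},\mathbf{A}$ be two finite $k$-enhanced $\sigma$-structures with $X=[k]$, and let $g:\mathbf{X}^{\otimes k}\to\mathbb{F}_{\mathscr{Q}_{\mathrm{conv}}}(\mathbf{A}^{\otimes k})$ be a homomorphism. If $\mathbf{a}=(a_1,\dots,a_k)\in A^k$ satisfies $g((1,\dots,k))(\mathbf{a})\neq 0$, then the map $f:X\to A$, $j\mapsto a_j$, is a homomorphism from $\mathbf{X}$ to $\mathbf{A}$.
   Context: A $\sigma$-structure $\mathbf{A}$ has domain $A$ and relations $R^{\mathbf{A}}\subseteq A^{\mathrm{ar}(R)}$; homomorphisms preserve all relations coordinatewise. For $\mathbf{x}=(x_1,\dots,x_r)$ and $\mathbf{i}=(i_1,\dots,i_\ell)\in[r]^\ell$, $\mathbf{x}_{\mathbf{i}}=(x_{i_1},\dots,x_{i_\ell})$. A $\sigma$-structure is $k$-enhanced if $\sigma$ contains a $k$-ary symbol $R_k$ with $R_k^{\mathbf{A}}=A^k$. Tensor power: $\mathbf{A}^{\otimes k}$ has the same symbols, where $R$ of arity $r$ gets arity $r^k$ with positions indexed by $[r]^k$; domain $A^k$; $R^{\mathbf{A}^{\otimes k}}=\{\mathbf{a}^{\otimes k}:\mathbf{a}\in R^{\mathbf{A}}\}$ with $\mathbf{a}^{\otimes k}$ the family whose $\mathbf{i}$-th entry is $\mathbf{a}_{\mathbf{i}}\in A^k$. Maps are applied to such families entrywise. $\mathbb{F}_{\mathscr{Q}_{\mathrm{conv}}}(\mathbf{A}^{\otimes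 k})$: domain is the set of nonnegative rational tensors indexed by $A^k$ with entries summing to $1$ ($T(\mathbf{a})$ is the $\mathbf{a}$-entry of $T$); a family $(M_{\mathbf{i}})_{\mathbf{i}\in[r]^k}$ is in $R^{\mathbb{F}_{\mathscr{Q}_{\mathrm{conv}}}(\mathbf{A}^{\otimes k})}$ iff there is a rational probability vector $q$ on $R^{\mathbf{A}}$ with $M_{\mathbf{i}}(\mathbf{a})=\sum_{\mathbf{b}\in R^{\mathbf{A}},\,\mathbf{b}_{\mathbf{i}}=\mathbf{a}}q(\mathbf{b})$ for all $\mathbf{i}\in[r]^k$, $\mathbf{a}\in A^k$. -}

module Defs where

open import Data.Nat using (ℕ; zero; suc)
open import Data.Fin using (Fin)
import Data.Fin as Fin
open import Data.Vec using (Vec; []; _∷_; map; lookup)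
open import Data.Vec.Properties using (≡-dec)
open import Data.List using (List; [_]; concatMap; foldr)
import Data.List as List
open import Data.Rational using (ℚ; 0ℚ; 1ℚ; _+_; _≤_)
open import Data.Product using (Σ; _×_; ∃)
open import Relation.Binary.PropositionalEquality using (_≡_; _≢_)
open import Relation.Nullary.Decidable using (⌊_⌋)
open import Data.Bool using (if_then_else_)

record Signature : Set₁ where
  field
    Sym : Set
    ar  : Sym → ℕ
open Signature public

record Structure (σ : Signature) (n : ℕ) : Set₁ where
  field
    rel : (R : Sym σ) → Vec (Fin n) (ar σ R) → Set
open Structure public

_⟨_⟩ : ∀ {D : Set} {r ℓ} → Vec D r → Vec (Fin r) ℓ → Vec D ℓ
x ⟨ i ⟩ = map (lookup x) i

IsEnhanced : ∀ {σ n} (k : ℕ) → Structure σ n → Set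
IsEnhanced {σ} k A = Σ (Sym σ) λ R → Σ (ar σ R ≡ k) λ _ → ∀ x → rel A R x

IsHom : ∀ {σ n m} → Structure σ n → Structure σ m → (Fin n → Fin m) → Set
IsHom {σ} X A f = ∀ (R : Sym σ) x → rel X R x → rel A R (map f x)

allVecs : (m k : ℕ) → List (Vec (Fin m) k)
allVecs m zero = [ [] ]
allVecs m (suc k) = concatMap (λ x → List.map (x ∷_) (allVecs m k)) (List.allFin m)

sumℚ : List ℚ → ℚ
sumℚ = foldr _+_ 0ℚ

Σ-tuples : (m k : ℕ) → (Vec (Fin m) k → ℚ) → ℚ
Σ-tuples m k f = sumℚ (List.map f (allVecs m k))

-- Tensor power A^{⊗k}: relation R (positions indexed by [r]^k) consists of a^{⊗k}, a ∈ R^A.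
TensorRel : ∀ {σ n} (A : Structure σ n) (k : ℕ) (R : Sym σ) →
            (Vec (Fin (ar σ R)) k → Vec (Fin n) k) → Set
TensorRel {σ} {n} A k R F =
  Σ (Vec (Fin n) (ar σ R)) λ a → rel A R a × (∀ i → F i ≡ a ⟨ i ⟩)

-- Elements of F_{Q_conv}(A^{⊗k}): nonnegative rational tensors indexed by A^k summing to 1.
record ConvTensor (m k : ℕ) : Set where
  field
    entry   : Vec (Fin m) k → ℚ
    nonneg  : ∀ a → 0ℚ ≤ entry a
    sum-one : Σ-tuples m k entry ≡ 1ℚ
open ConvTensor public

-- Relation R of F_{Q_conv}(A^{⊗k}). The rational probability vector q on R^A is encoded
-- as q : A^r → ℚ, nonnegative, vanishing outside R^A, summing to 1.
FreeRel : ∀ {σ m} (A : Structure σ m) (k : ℕ) (R : Sym σ) →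
          (Vec (Fin (ar σ R)) k → ConvTensor m k) → Set
FreeRel {σ} {m} A k R M =
  Σ (Vec (Fin m) (ar σ R) → ℚ) λ q →
    (∀ b → 0ℚ ≤ q b) ×
    (∀ b → q b ≢ 0ℚ → rel A R b) ×
    (Σ-tuples m (ar σ R) q ≡ 1ℚ) ×
    (∀ i a → entry (M i) a ≡
       Σ-tuples m (ar σ R) (λ b → if ⌊ ≡-dec Fin._≟_ (b ⟨ i ⟩) a ⌋ then q b else 0ℚ))

IsHomTensorFree : ∀ {σ n m} (X : Structure σ n) (A : Structure σ m) (k : ℕ) →
                  (Vec (Fin n) k → ConvTensor m k) → Set
IsHomTensorFree {σ} X A k g =
  ∀ (R : Sym σ) F → TensorRel X k R F → FreeRel A k R (λ i → g (F i))

{-# OPTIONS --safe #-}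
module Submission where

-- Since X is k-enhanced, its tensor power relates the identity family w ↦ w on [k]^k,
-- so g(w) is the law of c_w for c drawn from a single distribution q′ on A^k; and
-- q′(a) ≠ 0 as g(1,…,k)(a) ≠ 0. For x ∈ R^X with witness q on R^A, g(x_i) is the law of b_i for
-- b ∼ q. Taking i = (p, p′, …) (here k ≥ 2 is used) shows that every b in the support
-- of q satisfies b_p = b_p′ whenever x_p = x_p′. Taking i to pick a preimage under x
-- of every point of the image of x, g(x_i) charges a_{x_i} since q′(a) ≠ 0, so some b
-- in the support of q agrees with a ∘ x at those preimages, hence everywhere: a ∘ x ∈ R^A.

open import Defs
open import Data.Bool using (if_then_else_)
open import Data.Empty using (⊥-elim)
open import Data.Fin using (Fin)
import Data.Fin as Fin
open import Data.Fin.Properties using (any?)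
open import Data.List using ([]; _∷_)
import Data.List as List
open import Data.List.Membership.Propositional using (_∈_)
open import Data.List.Membership.Propositional.Properties using (∈-allFin; ∈-concatMap⁺; ∈-map⁺)
open import Data.List.Relation.Unary.Any using (here; there)
import Data.List.Relation.Unary.Any as Any
open import Data.Nat using (ℕ; zero; suc; _≤_; s≤s)
open import Data.Product using (∃; _×_; _,_)
open import Data.Rational using (ℚ; 0ℚ; 1ℚ; _+_) renaming (_≤_ to _≤ℚ_)
open import Data.Rational.Properties
  using (1≢0; ≤-refl; ≤-antisym; +-comm; +-identityˡ; +-identityʳ; +-mono-≤; +-monoʳ-≤)
  renaming (_≟_ to _≟ℚ_)
open import Data.Vec using (Vec; []; _∷_; map; lookup; allFin; tabulate; replicate; _[_]≔_)
open import Data.Vec.Properties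
  using (≡-dec; lookup-map; lookup∘tabulate; map-lookup-allFin; map-cong; map-id; lookup-allFin;
         lookup-replicate; lookup∘update; lookup∘update′)
open import Data.Vec.Relation.Binary.Pointwise.Extensional using (ext; Pointwise-≡⇒≡)
open import Relation.Binary.PropositionalEquality
open import Relation.Nullary using (yes; no)
open import Relation.Nullary.Decidable using (⌊_⌋)

p≤p+q : ∀ p {q} → 0ℚ ≤ℚ q → p ≤ℚ p + q
p≤p+q p {q} 0≤q = subst (_≤ℚ p + q) (+-identityʳ p) (+-monoʳ-≤ p 0≤q)

q≤p+q : ∀ {p} q → 0ℚ ≤ℚ p → q ≤ℚ p + q
q≤p+q {p} q 0≤p = subst (q ≤ℚ_) (+-comm q p) (p≤p+q q 0≤p)

module _ {B : Set} (f : B → ℚ) where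

  sumℚ-map-≢0⇒∃ : ∀ bs → sumℚ (List.map f bs) ≢ 0ℚ → ∃ λ b → f b ≢ 0ℚ
  sumℚ-map-≢0⇒∃ []       s≢0 = ⊥-elim (s≢0 refl)
  sumℚ-map-≢0⇒∃ (b ∷ bs) s≢0 with f b ≟ℚ 0ℚ
  ... | no fb≢0  = b , fb≢0
  ... | yes fb≡0 = sumℚ-map-≢0⇒∃ bs λ s≡0 →
    s≢0 (trans (cong₂ _+_ fb≡0 s≡0) (+-identityˡ 0ℚ))

  sumℚ-map-≡0 : (∀ b → f b ≡ 0ℚ) → ∀ bs → sumℚ (List.map f bs) ≡ 0ℚ
  sumℚ-map-≡0 f≡0 []       = refl
  sumℚ-map-≡0 f≡0 (b ∷ bs) = trans (cong₂ _+_ (f≡0 b) (sumℚ-map-≡0 f≡0 bs)) (+-identityˡ 0ℚ)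

  module _ (f≥0 : ∀ b → 0ℚ ≤ℚ f b) where

    sumℚ-map-nonNeg : ∀ bs → 0ℚ ≤ℚ sumℚ (List.map f bs)
    sumℚ-map-nonNeg []       = ≤-refl
    sumℚ-map-nonNeg (b ∷ bs) =
      subst (_≤ℚ f b + sumℚ (List.map f bs)) (+-identityˡ 0ℚ) (+-mono-≤ (f≥0 b) (sumℚ-map-nonNeg bs))

    ∈⇒sumℚ-map-≢0 : ∀ {b bs} → b ∈ bs → f b ≢ 0ℚ → sumℚ (List.map f bs) ≢ 0ℚ
    ∈⇒sumℚ-map-≢0 {bs = c ∷ bs} (here refl) fc≢0 s≡0 =
      fc≢0 (≤-antisym (subst (f c ≤ℚ_) s≡0 (p≤p+q (f c) (sumℚ-map-nonNeg bs))) (f≥0 c))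
    ∈⇒sumℚ-map-≢0 {bs = c ∷ bs} (there b∈bs) fb≢0 s≡0 =
      ∈⇒sumℚ-map-≢0 b∈bs fb≢0
        (≤-antisym (subst (_ ≤ℚ_) s≡0 (q≤p+q _ (f≥0 c))) (sumℚ-map-nonNeg bs))

∈-allVecs : ∀ m n (b : Vec (Fin m) n) → b ∈ allVecs m n
∈-allVecs m zero    []      = here refl
∈-allVecs m (suc n) (x ∷ b) =
  ∈-concatMap⁺ (λ y → List.map (y ∷_) (allVecs m n))
    (Any.map (λ { refl → ∈-map⁺ (x ∷_) (∈-allVecs m n b) }) (∈-allFin x))

allFin-⟨⟩ : ∀ {k ℓ} (w : Vec (Fin k) ℓ) → allFin k ⟨ w ⟩ ≡ w
allFin-⟨⟩ w = trans (map-cong lookup-allFin w) (map-id w)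

lookup-⟨⟩ : ∀ {D : Set} {r ℓ} (v : Vec D r) (i : Vec (Fin r) ℓ) j →
            lookup (v ⟨ i ⟩) j ≡ lookup v (lookup i j)
lookup-⟨⟩ v i j = lookup-map j (lookup v) i

onFibre : ∀ {m n ℓ} → (Vec (Fin m) n → ℚ) → Vec (Fin n) ℓ → Vec (Fin m) ℓ → Vec (Fin m) n → ℚ
onFibre q i a b = if ⌊ ≡-dec Fin._≟_ (b ⟨ i ⟩) a ⌋ then q b else 0ℚ

marginal : ∀ {m n ℓ} → (Vec (Fin m) n → ℚ) → Vec (Fin n) ℓ → Vec (Fin m) ℓ → ℚ
marginal {m} {n} q i a = Σ-tuples m n (onFibre q i a)

module _ {m n ℓ} (q : Vec (Fin m) n → ℚ) (i : Vec (Fin n) ℓ) (a : Vec (Fin m) ℓ) where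

  onFibre-in : ∀ {b} → b ⟨ i ⟩ ≡ a → onFibre q i a b ≡ q b
  onFibre-in {b} bi≡a with ≡-dec Fin._≟_ (b ⟨ i ⟩) a
  ... | yes _    = refl
  ... | no bi≢a = ⊥-elim (bi≢a bi≡a)

  onFibre-out : ∀ {b} → b ⟨ i ⟩ ≢ a → onFibre q i a b ≡ 0ℚ
  onFibre-out {b} bi≢a with ≡-dec Fin._≟_ (b ⟨ i ⟩) a
  ... | yes bi≡a = ⊥-elim (bi≢a bi≡a)
  ... | no _     = refl

  onFibre-≢0 : ∀ b → onFibre q i a b ≢ 0ℚ → b ⟨ i ⟩ ≡ a × q b ≢ 0ℚ
  onFibre-≢0 b ≢0 with ≡-dec Fin._≟_ (b ⟨ i ⟩) a
  ... | yes bi≡a = bi≡a , ≢0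
  ... | no  _    = ⊥-elim (≢0 refl)

  onFibre-nonNeg : (∀ b → 0ℚ ≤ℚ q b) → ∀ b → 0ℚ ≤ℚ onFibre q i a b
  onFibre-nonNeg q≥0 b with ≡-dec Fin._≟_ (b ⟨ i ⟩) a
  ... | yes _ = q≥0 b
  ... | no  _ = ≤-refl

  marginal-≢0⇒∃ : marginal q i a ≢ 0ℚ → ∃ λ b → b ⟨ i ⟩ ≡ a × q b ≢ 0ℚ
  marginal-≢0⇒∃ ≢0 with sumℚ-map-≢0⇒∃ (onFibre q i a) (allVecs m n) ≢0
  ... | b , fb≢0 = b , onFibre-≢0 b fb≢0

  marginal-≡0 : (∀ b → b ⟨ i ⟩ ≢ a) → marginal q i a ≡ 0ℚ
  marginal-≡0 off = sumℚ-map-≡0 (onFibre q i a) (λ b → onFibre-out (off b)) (allVecs m n)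

  marginal-≡0-diagonal : ∀ {s t} → lookup i s ≡ lookup i t → lookup a s ≢ lookup a t →
                         marginal q i a ≡ 0ℚ
  marginal-≡0-diagonal {s} {t} is≡it as≢at = marginal-≡0 λ b bi≡a → as≢at (begin
    lookup a s            ≡⟨ cong (λ v → lookup v s) bi≡a ⟨
    lookup (b ⟨ i ⟩) s    ≡⟨ lookup-⟨⟩ b i s ⟩
    lookup b (lookup i s) ≡⟨ cong (lookup b) is≡it ⟩
    lookup b (lookup i t) ≡⟨ lookup-⟨⟩ b i t ⟨
    lookup (b ⟨ i ⟩) t    ≡⟨ cong (λ v → lookup v t) bi≡a ⟩
    lookup a t            ∎)
    where open ≡-Reasoning

marginal-≢0 : ∀ {m n ℓ} {q : Vec (Fin m) n → ℚ} → (∀ b → 0ℚ ≤ℚ q b) →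
              (i : Vec (Fin n) ℓ) → ∀ {b} → q b ≢ 0ℚ → marginal q i (b ⟨ i ⟩) ≢ 0ℚ
marginal-≢0 {m} {n} {q = q} q≥0 i {b} qb≢0 =
  ∈⇒sumℚ-map-≢0 (onFibre q i (b ⟨ i ⟩)) (onFibre-nonNeg q i (b ⟨ i ⟩) q≥0) (∈-allVecs m n b)
    (λ fb≡0 → qb≢0 (trans (sym (onFibre-in q i (b ⟨ i ⟩) refl)) fb≡0))

-- Definitionally the last component of FreeRel A k R (λ i → g (x ⟨ i ⟩)).
IsMarginalFamilyAlong : ∀ {k m r} → (Vec (Fin k) k → ConvTensor m k) →
                   Vec (Fin k) r → (Vec (Fin m) r → ℚ) → Set
IsMarginalFamilyAlong {k} g x q = ∀ (i : Vec (Fin _) k) a → entry (g (x ⟨ i ⟩)) a ≡ marginal q i a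

IsMarginalFamily : ∀ {k m} → (Vec (Fin k) k → ConvTensor m k) → (Vec (Fin m) k → ℚ) → Set
IsMarginalFamily {k} g q = ∀ (w : Vec (Fin k) k) a → entry (g w) a ≡ marginal q w a

enhanced⇒isMarginalFamily : ∀ {σ k m} (X : Structure σ k) (A : Structure σ m) (g : Vec (Fin k) k → ConvTensor m k) →
                       IsEnhanced k X → IsHomTensorFree X A k g →
                       ∃ λ q → (∀ b → 0ℚ ≤ℚ q b) × IsMarginalFamily g q
enhanced⇒isMarginalFamily X A g (R , refl , full) g-hom
  with q , q≥0 , _ , _ , g≡marginal ← g-hom R (allFin _ ⟨_⟩) (allFin _ , full _ , λ _ → refl)
  = q , q≥0 , λ w a → subst (λ v → entry (g v) a ≡ marginal q w a) (allFin-⟨⟩ w) (g≡marginal w a)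

module _ {k r} (x : Vec (Fin k) (suc r)) where

  -- The default Fin.zero, off the image of x, is never used.
  preimage : Fin k → Fin (suc r)
  preimage j with any? (λ p → lookup x p Fin.≟ j)
  ... | yes (p , _) = p
  ... | no _        = Fin.zero

  lookup-preimage : ∀ p → lookup x (preimage (lookup x p)) ≡ lookup x p
  lookup-preimage p with any? (λ p′ → lookup x p′ Fin.≟ lookup x p)
  ... | yes (_ , xp′≡xp) = xp′≡xp
  ... | no ∄p′           = ⊥-elim (∄p′ (p , refl))

  preimages : Vec (Fin (suc r)) k
  preimages = tabulate preimage

  lookup-⟨preimages⟩ : ∀ {D : Set} (v : Vec D (suc r)) j → lookup (v ⟨ preimages ⟩) j ≡ lookup v (preimage j)
  lookup-⟨preimages⟩ v j = trans (lookup-⟨⟩ v preimages j) (cong (lookup v) (lookup∘tabulate preimage j))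

module _ {k m} (g : Vec (Fin k) k → ConvTensor m k) {q′ : Vec (Fin m) k → ℚ}
         (q′≥0 : ∀ c → 0ℚ ≤ℚ q′ c) (g≡q′ : IsMarginalFamily g q′) where

  entry-allFin≢0⇒≢0 : ∀ {a} → entry (g (allFin k)) a ≢ 0ℚ → q′ a ≢ 0ℚ
  entry-allFin≢0⇒≢0 {a} ga≢0
    with c , c≡a , q′c≢0 ← marginal-≢0⇒∃ q′ (allFin k) a (λ ≡0 → ga≢0 (trans (g≡q′ _ a) ≡0))
    = subst (λ v → q′ v ≢ 0ℚ) (trans (sym (map-lookup-allFin c)) c≡a) q′c≢0

  module _ {r} {x : Vec (Fin k) r} {q : Vec (Fin m) r → ℚ}
           (q≥0 : ∀ b → 0ℚ ≤ℚ q b) (g≡q : IsMarginalFamilyAlong g x q) where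

    -- Along ι with ι_s = p and ι_t = p′, q has the marginal g(x_ι), and (x_ι)_s = (x_ι)_t,
    -- so this marginal, a marginal of q′, vanishes at b_ι unless b_p = b_p′.
    support-respects-kernel : ∀ {s t : Fin k} → s ≢ t → ∀ {b} → q b ≢ 0ℚ →
                              ∀ {p p′} → lookup x p ≡ lookup x p′ → lookup b p ≡ lookup b p′
    support-respects-kernel {s} {t} s≢t {b} qb≢0 {p} {p′} xp≡xp′ with lookup b p Fin.≟ lookup b p′
    ... | yes bp≡bp′ = bp≡bp′
    ... | no  bp≢bp′ = ⊥-elim (marginal-≢0 q≥0 ι qb≢0 (begin
      marginal q ι (b ⟨ ι ⟩)         ≡⟨ g≡q ι (b ⟨ ι ⟩) ⟨
      entry (g (x ⟨ ι ⟩)) (b ⟨ ι ⟩)  ≡⟨ g≡q′ (x ⟨ ι ⟩) (b ⟨ ι ⟩) ⟩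
      marginal q′ (x ⟨ ι ⟩) (b ⟨ ι ⟩) ≡⟨ marginal-≡0-diagonal q′ (x ⟨ ι ⟩) (b ⟨ ι ⟩) x-diagonal b-off-diagonal ⟩
      0ℚ                             ∎))
      where
      open ≡-Reasoning
      ι : Vec (Fin r) k
      ι = replicate k p′ [ s ]≔ p

      ι-s : ∀ {D : Set} (v : Vec D r) → lookup (v ⟨ ι ⟩) s ≡ lookup v p
      ι-s v = trans (lookup-⟨⟩ v ι s) (cong (lookup v) (lookup∘update s (replicate k p′) p))

      ι-t : ∀ {D : Set} (v : Vec D r) → lookup (v ⟨ ι ⟩) t ≡ lookup v p′
      ι-t v = trans (lookup-⟨⟩ v ι t)
        (cong (lookup v) (trans (lookup∘update′ (λ t≡s → s≢t (sym t≡s)) (replicate k p′) p)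
                                (lookup-replicate t p′)))

      x-diagonal : lookup (x ⟨ ι ⟩) s ≡ lookup (x ⟨ ι ⟩) t
      x-diagonal = trans (ι-s x) (trans xp≡xp′ (sym (ι-t x)))

      b-off-diagonal : lookup (b ⟨ ι ⟩) s ≢ lookup (b ⟨ ι ⟩) t
      b-off-diagonal e = bp≢bp′ (trans (sym (ι-s b)) (trans e (ι-t b)))

  agrees-on-preimages⇒≡ : ∀ {r} {x : Vec (Fin k) (suc r)} {q : Vec (Fin m) (suc r) → ℚ} →
                          (∀ b → 0ℚ ≤ℚ q b) → IsMarginalFamilyAlong g x q →
                          ∀ {s t : Fin k} → s ≢ t → ∀ {a b} → q b ≢ 0ℚ →
                          b ⟨ preimages x ⟩ ≡ a ⟨ x ⟨ preimages x ⟩ ⟩ → b ≡ map (lookup a) x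
  agrees-on-preimages⇒≡ {x = x} q≥0 g≡q s≢t {a} {b} qb≢0 b≡a = Pointwise-≡⇒≡ (ext λ p →
    let j = lookup x p in begin
    lookup b p                              ≡⟨ support-respects-kernel {x = x} q≥0 g≡q s≢t qb≢0 (sym (lookup-preimage x p)) ⟩
    lookup b (preimage x j)                 ≡⟨ lookup-⟨preimages⟩ x b j ⟨
    lookup (b ⟨ preimages x ⟩) j            ≡⟨ cong (λ v → lookup v j) b≡a ⟩
    lookup (a ⟨ x ⟨ preimages x ⟩ ⟩) j      ≡⟨ lookup-⟨⟩ a (x ⟨ preimages x ⟩) j ⟩
    lookup a (lookup (x ⟨ preimages x ⟩) j) ≡⟨ cong (lookup a) (lookup-⟨preimages⟩ x x j) ⟩
    lookup a (lookup x (preimage x j))      ≡⟨ cong (lookup a) (lookup-preimage x p) ⟩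
    lookup a j                              ≡⟨ lookup-map p (lookup a) x ⟨
    lookup (map (lookup a) x) p             ∎)
    where open ≡-Reasoning

  map-lookup-∈-support : ∀ {s t : Fin k} → s ≢ t → ∀ {a} → q′ a ≢ 0ℚ →
                         ∀ {r} (x : Vec (Fin k) r) {q : Vec (Fin m) r → ℚ} →
                         (∀ b → 0ℚ ≤ℚ q b) → Σ-tuples m r q ≡ 1ℚ → IsMarginalFamilyAlong g x q →
                         q (map (lookup a) x) ≢ 0ℚ
  map-lookup-∈-support _ _ [] {q} _ Σq≡1 _
    with [] , q[]≢0 ← sumℚ-map-≢0⇒∃ q (allVecs m 0) (λ Σq≡0 → 1≢0 (trans (sym Σq≡1) Σq≡0))
    = q[]≢0
  map-lookup-∈-support s≢t {a} q′a≢0 x@(_ ∷ _) {q} q≥0 _ g≡q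
    with b , b≡a , qb≢0 ← marginal-≢0⇒∃ q (preimages x) (a ⟨ x ⟨ preimages x ⟩ ⟩)
             (λ ≡0 → marginal-≢0 q′≥0 (x ⟨ preimages x ⟩) q′a≢0
                       (trans (sym (g≡q′ _ _)) (trans (g≡q (preimages x) _) ≡0)))
    = subst (λ v → q v ≢ 0ℚ) (agrees-on-preimages⇒≡ {x = x} q≥0 g≡q s≢t {a = a} qb≢0 b≡a) qb≢0

proposition5p7 : (σ : Signature) (k : ℕ) → 2 ≤ k → (m : ℕ)
    (X : Structure σ k) (A : Structure σ m) →
    IsEnhanced k X → IsEnhanced k A →
    (g : Vec (Fin k) k → ConvTensor m k) → IsHomTensorFree X A k g →
    (a : Vec (Fin m) k) → entry (g (allFin k)) a ≢ 0ℚ →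
    IsHom X A (lookup a)
proposition5p7 σ k (s≤s (s≤s _)) m X A X-enhanced _ g g-hom a ga≢0 R x x∈R
  with q′ , q′≥0 , g≡q′ ← enhanced⇒isMarginalFamily X A g X-enhanced g-hom
     | q , q≥0 , q-supported , Σq≡1 , g≡q ← g-hom R (x ⟨_⟩) (x , x∈R , λ _ → refl)
  = q-supported (map (lookup a) x)
      (map-lookup-∈-support g q′≥0 g≡q′ {Fin.zero} {Fin.suc Fin.zero} (λ ())
         (entry-allFin≢0⇒≢0 g q′≥0 g≡q′ ga≢0) x q≥0 Σq≡1 g≡q)
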